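{- Let $k$ and $d$ be positive integers which are not both even, and let $G=(V,E)$ be a finite simple graph with $p$ vertices and $q$ edges. If $G$ is $(k,d)$-hooked Skolem graceful, then $V$ can be partitioned into two subsets $V_o$ and $V_e$ such that: (1) $m(V_o,V_e)=\lfloor\frac{q+1}{2}\rfloor$ if $k$ and $d$ are both odd; (2) $m(V_o,V_e)=\lfloor\frac{q}{2}\rfloor$ if $k$ is even and $d$ is odd; (3) $m(V_o,V_e)=q$ if $k$ is odd and $d$ is even.
   Context: A graph $G=(V,E)$ with $p$ vertices and $q$ edges is called $(k,d)$-hooked Skolem graceful (for positive integers $k,d$) if there is a bijection $f:V\to\{1,2,\dots,p-1,p+1\}$ such that the induced edge labeling $g_f:E\to\{k,k+d,k+2d,\dots,k+(q-1)d\}$ given by $g_f(uv)=|f(u)-f(v)|$ for all $uv\in E$ is a bijection. For disjoint subsets $A,B\subseteq V$, $m(A,B)$ denotes the number of edges of $G$ with one end in $A$ and the other end in $B$. -}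

module Defs where

open import Data.Nat using (ℕ; zero; suc; _+_; _*_; _∸_; _<_; _≤_; _/_)
open import Data.Nat.Properties using (_≟_)
open import Data.Fin using (Fin)
open import Data.Bool using (Bool; true; false; _≟_)
open import Data.List using (List; []; _∷_; length; map; upTo; filter)
open import Data.List.Relation.Unary.Unique.Propositional using (Unique)
open import Data.List.Relation.Unary.All using (All)
open import Data.List.Relation.Binary.Permutation.Propositional using (_↭_)
open import Data.Product using (_×_; _,_; proj₁; proj₂; Σ; ∃)
open import Data.Sum using (_⊎_)
open import Relation.Binary.PropositionalEquality using (_≡_; _≢_)
open import Relation.Nullary using (¬_; Dec; yes; no)
open import Relation.Nullary.Decidable using (¬?)
open import Function.Definitions using (Injective)

-- A finite simple graph on vertex set Fin p, given by its list of edges.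
-- Each edge is an unordered pair {u,v}, represented by an ordered pair (u , v).
record Graph (p : ℕ) : Set where
  field
    edges : List (Fin p × Fin p)

open Graph public

numEdges : ∀ {p} → Graph p → ℕ
numEdges G = length (edges G)

Simple : ∀ {p} → Graph p → Set
Simple {p} G =
  All (λ e → proj₁ e ≢ proj₂ e) (edges G) ×
  Unique (edges G) ×
  (∀ {u v} → (u , v) ∈ₑ edges G → ¬ ((v , u) ∈ₑ edges G))
  where
    open import Data.List.Membership.Propositional renaming (_∈_ to _∈ₑ_)

absDiff : ℕ → ℕ → ℕ
absDiff a b = (a ∸ b) + (b ∸ a)

AllowedLabel : ℕ → ℕ → Set
AllowedLabel p x = (1 ≤ x × x ≤ p ∸ 1) ⊎ x ≡ suc p

edgeLabels : ∀ {p} → Graph p → (Fin p → ℕ) → List ℕ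
edgeLabels G f = map (λ e → absDiff (f (proj₁ e)) (f (proj₂ e))) (edges G)

arith : ℕ → ℕ → ℕ → List ℕ
arith k d q = map (λ i → k + i * d) (upTo q)

IsHSGLabeling : ∀ {p} → ℕ → ℕ → Graph p → (Fin p → ℕ) → Set
IsHSGLabeling {p} k d G f =
  -- f is a bijection V → {1,...,p-1,p+1}
  Injective _≡_ _≡_ f ×
  (∀ v → AllowedLabel p (f v)) ×
  (∀ x → AllowedLabel p x → ∃ λ v → f v ≡ x) ×
  -- g_f is a bijection E → {k, k+d, ..., k+(q-1)d}
  (edgeLabels G f ↭ arith k d (numEdges G))

HookedSkolemGraceful : ∀ {p} → ℕ → ℕ → Graph p → Set
HookedSkolemGraceful {p} k d G = Σ (Fin p → ℕ) (IsHSGLabeling k d G)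

-- a partition of V into V_o (side true) and V_e (side false);
-- m(V_o, V_e) = number of edges with ends on different sides
crossing : ∀ {p} → Graph p → (Fin p → Bool) → ℕ
crossing G s = length (filter (λ e → ¬? (s (proj₁ e) Data.Bool.≟ s (proj₂ e))) (edges G))

Even Odd : ℕ → Set
Even n = ∃ λ m → n ≡ 2 * m
Odd n = ∃ λ m → n ≡ suc (2 * m)

module Submission where

-- Colour each vertex by the parity of its label.  An edge uv then crosses the
-- partition exactly when |f(u) − f(v)| is odd, and since the edge labels are
-- a permutation of k, k+d, …, k+(q−1)d, m(V_o,V_e) is the number of odd terms
-- of that progression: every other term when d is odd (starting with an odd
-- one iff k is odd), and all terms when k is odd and d even.

open import Defs
open import Data.Nat using (ℕ; zero; suc; _/_; _<_; _+_; _*_; _∸_; _≤_; z≤n; s≤s; parity)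
open import Data.Nat.Properties using (m∸n+n≡m; ≤-total; m≤n⇒m∸n≡0; +-identityʳ; +-assoc)
open import Data.Nat.DivMod using (m/n≡1+[m∸n]/n)
open import Data.Parity.Base using (Parity; 0ℙ; 1ℙ) renaming (_+_ to _⊕_)
open import Data.Parity.Properties as ℙ using (_≟_; +-homo-+; *-homo-*; p+p≡0ℙ)
open import Data.Bool using (Bool; true; false)
open import Data.Fin using (Fin)
open import Data.Product using (_×_; Σ; _,_; proj₁; proj₂)
open import Data.Sum using (inj₁; inj₂)
open import Data.List using (List; []; _∷_; length; map; filter; upTo; applyUpTo)
open import Data.List.Properties using (filter-≐; filter-accept; filter-reject; map-cong; map-∘; map-upTo)
open import Data.List.Relation.Binary.Permutation.Propositional using (_↭_)
open import Data.List.Relation.Binary.Permutation.Propositional.Properties using (↭-length; filter-↭)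
open import Function using (_∘_)
open import Relation.Binary.PropositionalEquality using (_≡_; _≢_; refl; sym; trans; cong; cong₂; module ≡-Reasoning)
open import Relation.Nullary using (¬_; yes; no)
open import Relation.Unary using (Pred; Decidable; _≐_)

open ≡-Reasoning

parity-∸ : ∀ {m n} → n ≤ m → parity (m ∸ n) ≡ parity m ⊕ parity n
parity-∸ {m} {n} n≤m = begin
  parity (m ∸ n)                          ≡⟨ sym (ℙ.+-identityʳ _) ⟩
  parity (m ∸ n) ⊕ 0ℙ                     ≡⟨ cong (parity (m ∸ n) ⊕_) (sym (p+p≡0ℙ (parity n))) ⟩
  parity (m ∸ n) ⊕ (parity n ⊕ parity n)  ≡⟨ sym (ℙ.+-assoc (parity (m ∸ n)) _ _) ⟩
  parity (m ∸ n) ⊕ parity n ⊕ parity n    ≡⟨ cong (_⊕ parity n) (sym (+-homo-+ (m ∸ n) n)) ⟩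
  parity (m ∸ n + n) ⊕ parity n           ≡⟨ cong (λ x → parity x ⊕ parity n) (m∸n+n≡m n≤m) ⟩
  parity m ⊕ parity n                     ∎

parity-absDiff : ∀ m n → parity (absDiff m n) ≡ parity m ⊕ parity n
parity-absDiff m n with ≤-total n m
... | inj₁ n≤m rewrite m≤n⇒m∸n≡0 n≤m | +-identityʳ (m ∸ n) = parity-∸ n≤m
... | inj₂ m≤n rewrite m≤n⇒m∸n≡0 m≤n = trans (parity-∸ m≤n) (ℙ.+-comm (parity n) (parity m))

parity-even : ∀ {n} → Even n → parity n ≡ 0ℙ
parity-even (m , refl) = *-homo-* 2 m

parity-odd : ∀ {n} → Odd n → parity n ≡ 1ℙ
parity-odd (m , refl) = trans (+-homo-+ 1 (2 * m)) (cong (1ℙ ⊕_) (*-homo-* 2 m))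

oddᵇ : Parity → Bool
oddᵇ 0ℙ = false
oddᵇ 1ℙ = true

oddᵇ-≢⇒⊕≡1ℙ : ∀ p q → oddᵇ p ≢ oddᵇ q → p ⊕ q ≡ 1ℙ
oddᵇ-≢⇒⊕≡1ℙ 0ℙ 0ℙ p≢q with () ← p≢q refl
oddᵇ-≢⇒⊕≡1ℙ 0ℙ 1ℙ _ = refl
oddᵇ-≢⇒⊕≡1ℙ 1ℙ 0ℙ _ = refl
oddᵇ-≢⇒⊕≡1ℙ 1ℙ 1ℙ p≢q with () ← p≢q refl

⊕≡1ℙ⇒oddᵇ-≢ : ∀ p q → p ⊕ q ≡ 1ℙ → oddᵇ p ≢ oddᵇ q
⊕≡1ℙ⇒oddᵇ-≢ 0ℙ 1ℙ _ ()
⊕≡1ℙ⇒oddᵇ-≢ 1ℙ 0ℙ _ ()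

length-filter-map : ∀ {A B : Set} {ℓ} {P : Pred B ℓ} (P? : Decidable P) (g : A → B) xs →
  length (filter P? (map g xs)) ≡ length (filter (P? ∘ g) xs)
length-filter-map P? g [] = refl
length-filter-map P? g (x ∷ xs) with P? (g x)
... | yes _ = cong suc (length-filter-map P? g xs)
... | no _  = length-filter-map P? g xs

odd? : Decidable (λ n → parity n ≡ 1ℙ)
odd? n = parity n ≟ 1ℙ

oddCount : List ℕ → ℕ
oddCount = length ∘ filter odd?

oddCount-↭ : ∀ {ms ns} → ms ↭ ns → oddCount ms ≡ oddCount ns
oddCount-↭ = ↭-length ∘ filter-↭ odd?

oddCount-odd∷ : ∀ n ns → parity n ≡ 1ℙ → oddCount (n ∷ ns) ≡ suc (oddCount ns)
oddCount-odd∷ n ns n-odd = cong length (filter-accept odd? {n} {ns} n-odd)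

oddCount-even∷ : ∀ n ns → parity n ≡ 0ℙ → oddCount (n ∷ ns) ≡ oddCount ns
oddCount-even∷ n ns n-even = cong length (filter-reject odd? {n} {ns} n-not-odd)
  where
  n-not-odd : parity n ≢ 1ℙ
  n-not-odd n-odd with () ← trans (sym n-even) n-odd

crossing-parity : ∀ {p} (G : Graph p) (f : Fin p → ℕ) →
  crossing G (oddᵇ ∘ parity ∘ f) ≡ oddCount (edgeLabels G f)
crossing-parity {p} G f = begin
  crossing G side                           ≡⟨ cong length (filter-≐ _ (odd? ∘ label) sides≐labels (edges G)) ⟩
  length (filter (odd? ∘ label) (edges G))  ≡⟨ sym (length-filter-map odd? label (edges G)) ⟩
  oddCount (edgeLabels G f)                 ∎
  where
  side : Fin p → Bool
  side = oddᵇ ∘ parity ∘ f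
  label : Fin p × Fin p → ℕ
  label (u , v) = absDiff (f u) (f v)
  sides≐labels : (λ e → side (proj₁ e) ≢ side (proj₂ e)) ≐ (λ e → parity (label e) ≡ 1ℙ)
  sides≐labels =
    (λ {(u , v)} ≢ → trans (parity-absDiff (f u) (f v)) (oddᵇ-≢⇒⊕≡1ℙ _ _ ≢)) ,
    (λ {(u , v)} odd → ⊕≡1ℙ⇒oddᵇ-≢ _ _ (trans (sym (parity-absDiff (f u) (f v))) odd))

arith-suc : ∀ k d q → arith k d (suc q) ≡ k ∷ arith (k + d) d q
arith-suc k d q = cong₂ _∷_ (+-identityʳ k) (begin
  map (λ i → k + i * d) (applyUpTo suc q)   ≡⟨ cong (map _) (sym (map-upTo suc q)) ⟩
  map (λ i → k + i * d) (map suc (upTo q))  ≡⟨ sym (map-∘ (upTo q)) ⟩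
  map (λ i → k + (d + i * d)) (upTo q)      ≡⟨ map-cong (λ i → sym (+-assoc k d (i * d))) (upTo q) ⟩
  arith (k + d) d q                         ∎)

suc-suc/2 : ∀ q → suc (suc q) / 2 ≡ suc (q / 2)
suc-suc/2 q = m/n≡1+[m∸n]/n {suc (suc q)} {2} (s≤s (s≤s z≤n))

oddCount-arith-odd-odd : ∀ {k d} q → parity k ≡ 1ℙ → parity d ≡ 1ℙ →
  oddCount (arith k d q) ≡ suc q / 2
oddCount-arith-even-odd : ∀ {k d} q → parity k ≡ 0ℙ → parity d ≡ 1ℙ →
  oddCount (arith k d q) ≡ q / 2

oddCount-arith-odd-odd zero _ _ = refl
oddCount-arith-odd-odd {k} {d} (suc q) k-odd d-odd = begin
  oddCount (arith k d (suc q))        ≡⟨ cong oddCount (arith-suc k d q) ⟩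
  oddCount (k ∷ arith (k + d) d q)    ≡⟨ oddCount-odd∷ k (arith (k + d) d q) k-odd ⟩
  suc (oddCount (arith (k + d) d q))  ≡⟨ cong suc (oddCount-arith-even-odd q k+d-even d-odd) ⟩
  suc (q / 2)                         ≡⟨ sym (suc-suc/2 q) ⟩
  suc (suc q) / 2                     ∎
  where
  k+d-even : parity (k + d) ≡ 0ℙ
  k+d-even = trans (+-homo-+ k d) (cong₂ _⊕_ k-odd d-odd)

oddCount-arith-even-odd zero _ _ = refl
oddCount-arith-even-odd {k} {d} (suc q) k-even d-odd = begin
  oddCount (arith k d (suc q))      ≡⟨ cong oddCount (arith-suc k d q) ⟩
  oddCount (k ∷ arith (k + d) d q)  ≡⟨ oddCount-even∷ k (arith (k + d) d q) k-even ⟩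
  oddCount (arith (k + d) d q)      ≡⟨ oddCount-arith-odd-odd q k+d-odd d-odd ⟩
  suc q / 2                         ∎
  where
  k+d-odd : parity (k + d) ≡ 1ℙ
  k+d-odd = trans (+-homo-+ k d) (cong₂ _⊕_ k-even d-odd)

oddCount-arith-odd-even : ∀ {k d} q → parity k ≡ 1ℙ → parity d ≡ 0ℙ →
  oddCount (arith k d q) ≡ q
oddCount-arith-odd-even zero _ _ = refl
oddCount-arith-odd-even {k} {d} (suc q) k-odd d-even = begin
  oddCount (arith k d (suc q))        ≡⟨ cong oddCount (arith-suc k d q) ⟩
  oddCount (k ∷ arith (k + d) d q)    ≡⟨ oddCount-odd∷ k (arith (k + d) d q) k-odd ⟩
  suc (oddCount (arith (k + d) d q))  ≡⟨ cong suc (oddCount-arith-odd-even q k+d-odd d-even) ⟩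
  suc q                               ∎
  where
  k+d-odd : parity (k + d) ≡ 1ℙ
  k+d-odd = trans (+-homo-+ k d) (cong₂ _⊕_ k-odd d-even)

mainTheorem1 : (k d p : ℕ) → 0 < k → 0 < d → ¬ (Even k × Even d) →
    (G : Graph p) → Simple G → HookedSkolemGraceful k d G →
    Σ (Fin p → Bool) λ side →
      ((Odd k × Odd d) → crossing G side ≡ suc (numEdges G) / 2) ×
      ((Even k × Odd d) → crossing G side ≡ numEdges G / 2) ×
      ((Odd k × Even d) → crossing G side ≡ numEdges G)
mainTheorem1 k d p _ _ _ G _ (f , _ , _ , _ , labels↭arith) =
  side ,
  (λ (k-odd , d-odd) → trans crossing≡ (oddCount-arith-odd-odd q (parity-odd k-odd) (parity-odd d-odd))) ,
  (λ (k-even , d-odd) → trans crossing≡ (oddCount-arith-even-odd q (parity-even k-even) (parity-odd d-odd))) ,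
  (λ (k-odd , d-even) → trans crossing≡ (oddCount-arith-odd-even q (parity-odd k-odd) (parity-even d-even)))
  where
  q : ℕ
  q = numEdges G
  side : Fin p → Bool
  side = oddᵇ ∘ parity ∘ f
  crossing≡ : crossing G side ≡ oddCount (arith k d q)
  crossing≡ = trans (crossing-parity G f) (oddCount-↭ labels↭arith)
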